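{- Let $d>1$, $0<\varepsilon<\varepsilon'<1$ and $r\ge 1$ an integer. Then $\mathcal{A}^d_{\varepsilon,r}$ can be verified by a proof labeling scheme in constant-time relative to $\mathcal{A}^d_{\varepsilon',r}$; that is, there exist a finite set $Q$, a positive integer $s$ and a verifier $\mathcal{V}\subset B^Q_{s,d}$ such that every $G\in\mathcal{A}^d_{\varepsilon,r}$ admits a $Q$-proof accepted by $\mathcal{V}$, and for every $H\in Gr_d\setminus\mathcal{A}^d_{\varepsilon',r}$ all $Q$-proofs on $H$ are rejected by $\mathcal{V}$.
   Context: $Gr_d$ is the set of finite simple graphs of maximum degree at most $d$, with shortest-path distance $d_G$. $B_r(x,G)$ is the subgraph induced on vertices at distance at most $r$ from $x$, rooted at $x$. For a finite set $Q$, a $Q$-proof on $G$ is a map $T:V(G)\to Q$; $B^{Q}_{s,d}$ is the set of rooted $Q$-vertex-labeled balls of radius at most $s$ and maximum degree at most $d$; a verifier $\mathcal{V}\subset B^Q_{s,d}$ accepts $T$ on $G$ if for every $x\in V(G)$ the labeled ball $B_s(x,G)$ with labels from $T$ lies in $\mathcal{V}$, and rejects $T$ otherwise. $\operatorname{Prob}(G)$ is the set of probability measures on $V(G)$, $\|f\|_1=\sum_{x}|f(x)|$. $G\in Gr_d$ is $(\varepsilon,r)$-uniform if there is $\tilde f:V(G)\to\operatorname{Prob}(G)$ with $\|\tilde f(x)-\tilde f(y)\|_1<\varepsilon$ for all adjacent $x,y$ and $\operatorname{Supp}(\tilde f(x))\subset B_r(x,G)$ for all $x$. $\mathcal{A}^d_{\varepsilon,r}$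 is the set of $(\varepsilon,r)$-uniform graphs in $Gr_d$.
   Formalization: The parameters ε and ε′ are rational, and the probability measures $\tilde f(x)$ in the definition of $(\varepsilon,r)$-uniformity take rational values. -}

module Defs where

open import Data.Nat as ℕ using (ℕ; zero; suc)
open import Data.Bool using (Bool; true; false; if_then_else_)
open import Data.Fin using (Fin; zero; suc)
open import Data.Product using (Σ; ∃; _×_; _,_)
open import Data.Sum using (_⊎_)
open import Relation.Binary.PropositionalEquality using (_≡_; _≢_)
open import Relation.Nullary using (¬_)
open import Data.Rational as ℚ using (ℚ; 0ℚ; 1ℚ)
open import Function.Definitions using (Injective)

record Graph : Set where
  field
    size  : ℕ
    adj   : Fin size → Fin size → Bool
    sym   : ∀ x y → adj x y ≡ adj y x
    irref : ∀ x → adj x x ≡ false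
open Graph public

sumℕ : ∀ {n} → (Fin n → ℕ) → ℕ
sumℕ {zero}  f = 0
sumℕ {suc n} f = f zero ℕ.+ sumℕ (λ i → f (suc i))

sumℚ : ∀ {n} → (Fin n → ℚ) → ℚ
sumℚ {zero}  f = 0ℚ
sumℚ {suc n} f = f zero ℚ.+ sumℚ (λ i → f (suc i))

degree : (G : Graph) → Fin (size G) → ℕ
degree G x = sumℕ (λ y → if adj G x y then 1 else 0)

MaxDeg≤ : ℕ → Graph → Set
MaxDeg≤ d G = ∀ x → degree G x ℕ.≤ d

data Within (G : Graph) : ℕ → Fin (size G) → Fin (size G) → Set where
  here : ∀ {k x} → Within G k x x
  step : ∀ {k x y z} → adj G x z ≡ true → Within G k z y → Within G (suc k) x y

IsProb : ∀ {n} → (Fin n → ℚ) → Set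
IsProb μ = (∀ y → 0ℚ ℚ.≤ μ y) × sumℚ μ ≡ 1ℚ

dist₁ : ∀ {n} → (Fin n → ℚ) → (Fin n → ℚ) → ℚ
dist₁ μ ν = sumℚ (λ z → ℚ.∣ μ z ℚ.- ν z ∣)

Uniform : ℚ → ℕ → Graph → Set
Uniform ε r G =
  Σ (Fin (size G) → Fin (size G) → ℚ) λ f →
    (∀ x → IsProb (f x)) ×
    (∀ x y → adj G x y ≡ true → dist₁ (f x) (f y) ℚ.< ε) ×
    (∀ x y → f x y ≢ 0ℚ → Within G r x y)

InA : ℕ → ℚ → ℕ → Graph → Set
InA d ε r G = MaxDeg≤ d G × Uniform ε r G

record LRGraph (q : ℕ) : Set where
  field
    graph : Graph
    label : Fin (size graph) → Fin q
    root  : Fin (size graph)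
open LRGraph public

IsBall : ∀ {q} → ℕ → ℕ → LRGraph q → Set
IsBall s d B = MaxDeg≤ d (graph B) × (∀ y → Within (graph B) s (root B) y)

IsoToBall : ∀ {q} (G : Graph) (T : Fin (size G) → Fin q) (s : ℕ) (x : Fin (size G))
            → LRGraph q → Set
IsoToBall G T s x B =
  Σ (Fin (size (graph B)) → Fin (size G)) λ φ →
    Injective _≡_ _≡_ φ ×
    (∀ i → Within G s x (φ i)) ×
    (∀ y → Within G s x y → ∃ λ i → φ i ≡ y) ×
    (∀ i j → adj (graph B) i j ≡ adj G (φ i) (φ j)) ×
    (∀ i → label B i ≡ T (φ i)) ×
    φ (root B) ≡ x

Accepts : ∀ {q} → (LRGraph q → Set) → ℕ → (G : Graph) → (Fin (size G) → Fin q) → Set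
Accepts V s G T = ∀ x → ∃ λ B → V B × IsoToBall G T s x B

Rejects : ∀ {q} → (LRGraph q → Set) → ℕ → (G : Graph) → (Fin (size G) → Fin q) → Set
Rejects V s G T = ¬ Accepts V s G T

{-# OPTIONS --safe #-}
-- A proof labels every vertex x with a colour and a weight vector w_x on colours.  The
-- colouring is proper on the graph of distances at most 2s, where s = r + 1, so inside each
-- s-ball colours name vertices and w_x describes a measure on B_r(x): each vertex gets the
-- weight of its colour.  The verifier checks that w_x has total mass N, lives on colours
-- seen within distance r of x, and satisfies ‖w_x − w_y‖₁ < N·ε′ for every neighbour y.
-- Divided by N, the decoded measures then show that the graph is (ε′, r)-uniform.  For an
-- (ε, r)-uniform graph, round N·f̃(x) down and put the missing mass on x.  This moves each
-- measure by at most 2|B_r(x)| ≤ 2·ballBound d r in ℓ¹, so neighbours differ by less than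
-- N·ε + 4·ballBound d r, which is at most N·ε′ once N is large.

module Submission where

open import Defs hiding (sym)
open import Data.Bool.Base using (true; if_then_else_)
open import Data.Empty using (⊥-elim)
open import Data.Fin.Base as Fin using (Fin; zero; suc; toℕ)
import Data.Fin.Properties as Fin
open import Data.Nat.Base as ℕ using (ℕ; zero; suc; z≤n; s≤s)
import Data.Nat.Properties as ℕ
open import Data.Product.Base using (Σ; ∃; _×_; _,_; proj₁; proj₂)
open import Data.Rational.Base as ℚ using (ℚ; 0ℚ; 1ℚ)
import Data.Rational.Properties as ℚ
open import Data.Unit.Base using (tt)
open import Data.Sum.Base using (_⊎_; inj₁; inj₂; [_,_]′)
open import Function.Base using (_∘_)
open import Relation.Nullary using (¬_; Dec; yes; no)
open import Relation.Binary.PropositionalEquality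

-- Indicators and finite sums

module _ where
  open import Data.Nat.Base using (_+_; _*_; _≤_; ∣_-_∣)
  open import Data.Nat.Properties
  open import Algebra.Properties.CommutativeSemigroup +-commutativeSemigroup using (interchange)

  𝟙 : ∀ {p} {P : Set p} → Dec P → ℕ
  𝟙 (yes _) = 1
  𝟙 (no _)  = 0

  module _ {p} {P : Set p} where

    𝟙≤1 : (P? : Dec P) → 𝟙 P? ≤ 1
    𝟙≤1 (yes _) = ≤-refl
    𝟙≤1 (no _)  = z≤n

    𝟙-yes : (P? : Dec P) → P → 𝟙 P? ≡ 1
    𝟙-yes (yes _) _  = refl
    𝟙-yes (no ¬p) p = ⊥-elim (¬p p)

    𝟙-no : (P? : Dec P) → ¬ P → 𝟙 P? ≡ 0
    𝟙-no (yes p) ¬p = ⊥-elim (¬p p)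
    𝟙-no (no _)  _  = refl

    𝟙≢0⇒ : (P? : Dec P) → 𝟙 P? ≢ 0 → P
    𝟙≢0⇒ (yes p) _   = p
    𝟙≢0⇒ (no _)  1≢0 = ⊥-elim (1≢0 refl)

    𝟙*≤ : (P? : Dec P) (m : ℕ) → 𝟙 P? * m ≤ m
    𝟙*≤ P? m = ≤-trans (*-monoˡ-≤ m (𝟙≤1 P?)) (≤-reflexive (*-identityˡ m))

    𝟙*≢0 : (P? : Dec P) (m : ℕ) → 𝟙 P? * m ≢ 0 → P × m ≢ 0
    𝟙*≢0 (yes p) m 1*m≢0 = p , λ m≡0 → 1*m≢0 (trans (+-identityʳ m) m≡0)
    𝟙*≢0 (no _)  m 0≢0   = ⊥-elim (0≢0 refl)

  𝟙-mono : ∀ {p q} {P : Set p} {Q : Set q} (P? : Dec P) (Q? : Dec Q) → (P → Q) → 𝟙 P? ≤ 𝟙 Q?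
  𝟙-mono (yes p) Q? P⇒Q = ≤-reflexive (sym (𝟙-yes Q? (P⇒Q p)))
  𝟙-mono (no _)  Q? P⇒Q = z≤n

  sumℕ-cong : ∀ {n} {f g : Fin n → ℕ} → (∀ i → f i ≡ g i) → sumℕ f ≡ sumℕ g
  sumℕ-cong {zero}  f≗g = refl
  sumℕ-cong {suc n} f≗g = cong₂ _+_ (f≗g zero) (sumℕ-cong (f≗g ∘ suc))

  sumℕ-mono : ∀ {n} {f g : Fin n → ℕ} → (∀ i → f i ≤ g i) → sumℕ f ≤ sumℕ g
  sumℕ-mono {zero}  f≤g = z≤n
  sumℕ-mono {suc n} f≤g = +-mono-≤ (f≤g zero) (sumℕ-mono (f≤g ∘ suc))

  sumℕ-+ : ∀ {n} (f g : Fin n → ℕ) → sumℕ (λ i → f i + g i) ≡ sumℕ f + sumℕ g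
  sumℕ-+ {zero}  f g = refl
  sumℕ-+ {suc n} f g = trans (cong (f zero + g zero +_) (sumℕ-+ (f ∘ suc) (g ∘ suc)))
                             (interchange (f zero) (g zero) _ _)

  sumℕ-*ʳ : ∀ {n} (f : Fin n → ℕ) (c : ℕ) → sumℕ (λ i → f i * c) ≡ sumℕ f * c
  sumℕ-*ʳ {zero}  f c = refl
  sumℕ-*ʳ {suc n} f c = trans (cong (f zero * c +_) (sumℕ-*ʳ (f ∘ suc) c))
                              (sym (*-distribʳ-+ c (f zero) _))

  sumℕ-*ˡ : ∀ {n} (c : ℕ) (f : Fin n → ℕ) → sumℕ (λ i → c * f i) ≡ c * sumℕ f
  sumℕ-*ˡ c f = trans (sumℕ-cong (λ i → *-comm c (f i))) (trans (sumℕ-*ʳ f c) (*-comm (sumℕ f) c))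

  sumℕ-zero : ∀ {n} {f : Fin n → ℕ} → (∀ i → f i ≡ 0) → sumℕ f ≡ 0
  sumℕ-zero {zero}  f≗0 = refl
  sumℕ-zero {suc n} f≗0 = cong₂ _+_ (f≗0 zero) (sumℕ-zero (f≗0 ∘ suc))

  sumℕ-one : ∀ n → sumℕ {n} (λ _ → 1) ≡ n
  sumℕ-one zero    = refl
  sumℕ-one (suc n) = cong suc (sumℕ-one n)

  sumℕ-comm : ∀ {m n} (f : Fin m → Fin n → ℕ) →
              sumℕ (λ i → sumℕ (f i)) ≡ sumℕ (λ j → sumℕ (λ i → f i j))
  sumℕ-comm {zero} {n} f = sym (sumℕ-zero {n} (λ _ → refl))
  sumℕ-comm {suc m} f = trans (cong (sumℕ (f zero) +_) (sumℕ-comm (f ∘ suc)))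
                              (sym (sumℕ-+ (f zero) _))

  ≤-sumℕ : ∀ {n} (f : Fin n → ℕ) k → f k ≤ sumℕ f
  ≤-sumℕ f zero    = m≤m+n _ _
  ≤-sumℕ f (suc k) = ≤-trans (≤-sumℕ (f ∘ suc) k) (m≤n+m _ (f zero))

  sumℕ-single : ∀ {n} (f : Fin n → ℕ) k → (∀ i → i ≢ k → f i ≡ 0) → sumℕ f ≡ f k
  sumℕ-single f zero    f≗0 = trans (cong (f zero +_) (sumℕ-zero (λ i → f≗0 (suc i) λ ())))
                                    (+-identityʳ _)
  sumℕ-single f (suc k) f≗0 = cong₂ _+_ (f≗0 zero λ ())
    (sumℕ-single (f ∘ suc) k (λ i i≢k → f≗0 (suc i) (i≢k ∘ Fin.suc-injective)))

  sumℕ≢0⇒ : ∀ {n} (f : Fin n → ℕ) → sumℕ f ≢ 0 → ∃ λ i → f i ≢ 0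
  sumℕ≢0⇒ {zero}  f Σ≢0 = ⊥-elim (Σ≢0 refl)
  sumℕ≢0⇒ {suc n} f Σ≢0 with f zero ℕ.≟ 0
  ... | no f₀≢0 = zero , f₀≢0
  ... | yes f₀≡0 =
    let i , fᵢ≢0 = sumℕ≢0⇒ (f ∘ suc) (λ Σ≡0 → Σ≢0 (cong₂ _+_ f₀≡0 Σ≡0)) in suc i , fᵢ≢0

  sumℕ-≤-unique : ∀ {n} (f : Fin n → ℕ) (b : ℕ) →
                  (∀ i j → f i ≢ 0 → f j ≢ 0 → i ≡ j) → (∀ i → f i ≤ b) → sumℕ f ≤ b
  sumℕ-≤-unique f b unique f≤b with sumℕ f ℕ.≟ 0
  ... | yes Σ≡0 = subst (_≤ b) (sym Σ≡0) z≤n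
  ... | no Σ≢0 with sumℕ≢0⇒ f Σ≢0
  ...   | k , fₖ≢0 = subst (_≤ b) (sym (sumℕ-single f k others)) (f≤b k)
    where
    others : ∀ i → i ≢ k → f i ≡ 0
    others i i≢k with f i ℕ.≟ 0
    ... | yes fᵢ≡0 = fᵢ≡0
    ... | no fᵢ≢0  = ⊥-elim (i≢k (unique i k fᵢ≢0 fₖ≢0))

  sumℕ-𝟙-≟ : ∀ {n} (k : Fin n) → sumℕ (λ j → 𝟙 (k Fin.≟ j)) ≡ 1
  sumℕ-𝟙-≟ k = trans (sumℕ-single _ k (λ j j≢k → 𝟙-no (k Fin.≟ j) (j≢k ∘ sym))) (𝟙-yes (k Fin.≟ k) refl)

  ∣m+n-o+p∣≤∣m-o∣+∣n-p∣ : ∀ m n o p → ∣ m + n - o + p ∣ ≤ ∣ m - o ∣ + ∣ n - p ∣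
  ∣m+n-o+p∣≤∣m-o∣+∣n-p∣ m n o p = begin
    ∣ m + n - o + p ∣                     ≤⟨ ∣-∣-triangle (m + n) (o + n) (o + p) ⟩
    ∣ m + n - o + n ∣ + ∣ o + n - o + p ∣ ≡⟨ cong₂ _+_ (trans (cong₂ ∣_-_∣ (+-comm m n) (+-comm o n))
                                                              (∣m+n-m+o∣≡∣n-o∣ n m o))
                                                       (∣m+n-m+o∣≡∣n-o∣ o n p) ⟩
    ∣ m - o ∣ + ∣ n - p ∣                 ∎
    where open ≤-Reasoning

  ∣sumℕ-sumℕ∣≤ : ∀ {n} (f g : Fin n → ℕ) → ∣ sumℕ f - sumℕ g ∣ ≤ sumℕ (λ i → ∣ f i - g i ∣)
  ∣sumℕ-sumℕ∣≤ {zero}  f g = z≤n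
  ∣sumℕ-sumℕ∣≤ {suc n} f g = ≤-trans (∣m+n-o+p∣≤∣m-o∣+∣n-p∣ (f zero) _ (g zero) _)
                                     (+-monoʳ-≤ ∣ f zero - g zero ∣ (∣sumℕ-sumℕ∣≤ (f ∘ suc) (g ∘ suc)))

  -- Pushforward and pullback of weights

  pushforward : ∀ {m n} → (Fin m → Fin n) → (Fin m → ℕ) → Fin n → ℕ
  pushforward κ p j = sumℕ (λ i → 𝟙 (κ i Fin.≟ j) * p i)

  module _ {m n} (κ : Fin m → Fin n) where

    sumℕ-pushforward : (p : Fin m → ℕ) → sumℕ (pushforward κ p) ≡ sumℕ p
    sumℕ-pushforward p = begin
      sumℕ (λ j → sumℕ (λ i → 𝟙 (κ i Fin.≟ j) * p i))
        ≡⟨ sumℕ-comm (λ i j → 𝟙 (κ i Fin.≟ j) * p i) ⟨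
      sumℕ (λ i → sumℕ (λ j → 𝟙 (κ i Fin.≟ j) * p i))
        ≡⟨ sumℕ-cong (λ i → sumℕ-*ʳ (λ j → 𝟙 (κ i Fin.≟ j)) (p i)) ⟩
      sumℕ (λ i → sumℕ (λ j → 𝟙 (κ i Fin.≟ j)) * p i)
        ≡⟨ sumℕ-cong (λ i → trans (cong (_* p i) (sumℕ-𝟙-≟ (κ i))) (*-identityˡ (p i))) ⟩
      sumℕ p
        ∎
      where open ≡-Reasoning

    ≤-pushforward : (p : Fin m → ℕ) (i : Fin m) → p i ≤ pushforward κ p (κ i)
    ≤-pushforward p i = subst (_≤ pushforward κ p (κ i)) term≡pᵢ (≤-sumℕ _ i)
      where
      term≡pᵢ : 𝟙 (κ i Fin.≟ κ i) * p i ≡ p i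
      term≡pᵢ = trans (cong (_* p i) (𝟙-yes (κ i Fin.≟ κ i) refl)) (*-identityˡ (p i))

    pushforward≢0⇒ : (p : Fin m → ℕ) (j : Fin n) → pushforward κ p j ≢ 0 → ∃ λ i → κ i ≡ j × p i ≢ 0
    pushforward≢0⇒ p j push≢0 = let i , termᵢ≢0 = sumℕ≢0⇒ _ push≢0 in i , 𝟙*≢0 (κ i Fin.≟ j) (p i) termᵢ≢0

    pushforward-contracts : (p p′ : Fin m → ℕ) →
      sumℕ (λ j → ∣ pushforward κ p j - pushforward κ p′ j ∣) ≤ sumℕ (λ i → ∣ p i - p′ i ∣)
    pushforward-contracts p p′ = begin
      sumℕ (λ j → ∣ pushforward κ p j - pushforward κ p′ j ∣)
        ≤⟨ sumℕ-mono (λ j → ∣sumℕ-sumℕ∣≤ (λ i → 𝟙 (κ i Fin.≟ j) * p i) (λ i → 𝟙 (κ i Fin.≟ j) * p′ i)) ⟩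
      sumℕ (λ j → sumℕ (λ i → ∣ 𝟙 (κ i Fin.≟ j) * p i - 𝟙 (κ i Fin.≟ j) * p′ i ∣))
        ≡⟨ sumℕ-cong (λ j → sumℕ-cong (λ i → sym (*-distribˡ-∣-∣ (𝟙 (κ i Fin.≟ j)) (p i) (p′ i)))) ⟩
      sumℕ (pushforward κ (λ i → ∣ p i - p′ i ∣))
        ≡⟨ sumℕ-pushforward (λ i → ∣ p i - p′ i ∣) ⟩
      sumℕ (λ i → ∣ p i - p′ i ∣)
        ∎
      where open ≤-Reasoning

    pullback : ∀ {s} {S : Fin m → Set s} → (∀ i → Dec (S i)) → (Fin n → ℕ) → Fin m → ℕ
    pullback S? w i = 𝟙 (S? i) * w (κ i)

    module _ {s} {S : Fin m → Set s} (S? : ∀ i → Dec (S i))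
             (κ-injective : ∀ {i i′} → S i → S i′ → κ i ≡ κ i′ → i ≡ i′) where

      fibre : Fin n → ℕ
      fibre j = sumℕ (λ i → 𝟙 (κ i Fin.≟ j) * 𝟙 (S? i))

      fibre≤1 : ∀ j → fibre j ≤ 1
      fibre≤1 j = sumℕ-≤-unique _ 1 unique (λ i → ≤-trans (𝟙*≤ (κ i Fin.≟ j) _) (𝟙≤1 (S? i)))
        where
        unique : ∀ i i′ → 𝟙 (κ i Fin.≟ j) * 𝟙 (S? i) ≢ 0 → 𝟙 (κ i′ Fin.≟ j) * 𝟙 (S? i′) ≢ 0 → i ≡ i′
        unique i i′ termᵢ≢0 termᵢ′≢0 =
          let κi≡j , Sᵢ≢0 = 𝟙*≢0 (κ i Fin.≟ j) _ termᵢ≢0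
              κi′≡j , Sᵢ′≢0 = 𝟙*≢0 (κ i′ Fin.≟ j) _ termᵢ′≢0
          in κ-injective (𝟙≢0⇒ (S? i) Sᵢ≢0) (𝟙≢0⇒ (S? i′) Sᵢ′≢0) (trans κi≡j (sym κi′≡j))

      1≤fibre : ∀ {i} → S i → 1 ≤ fibre (κ i)
      1≤fibre {i} Sᵢ = subst (_≤ fibre (κ i)) termᵢ≡1 (≤-sumℕ _ i)
        where
        termᵢ≡1 : 𝟙 (κ i Fin.≟ κ i) * 𝟙 (S? i) ≡ 1
        termᵢ≡1 = cong₂ _*_ (𝟙-yes (κ i Fin.≟ κ i) refl) (𝟙-yes (S? i) Sᵢ)

      pushforward-pullback : ∀ w j → pushforward κ (pullback S? w) j ≡ fibre j * w j
      pushforward-pullback w j = trans (sumℕ-cong term) (sumℕ-*ʳ (λ i → 𝟙 (κ i Fin.≟ j) * 𝟙 (S? i)) (w j))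
        where
        term : ∀ i → 𝟙 (κ i Fin.≟ j) * pullback S? w i ≡ 𝟙 (κ i Fin.≟ j) * 𝟙 (S? i) * w j
        term i with κ i Fin.≟ j
        ... | yes refl = sym (*-assoc 1 (𝟙 (S? i)) (w (κ i)))
        ... | no _     = refl

      sumℕ-pullback-≤ : ∀ w → sumℕ (pullback S? w) ≤ sumℕ w
      sumℕ-pullback-≤ w = begin
        sumℕ (pullback S? w)                  ≡⟨ sumℕ-pushforward (pullback S? w) ⟨
        sumℕ (pushforward κ (pullback S? w))  ≡⟨ sumℕ-cong (pushforward-pullback w) ⟩
        sumℕ (λ j → fibre j * w j)            ≤⟨ sumℕ-mono fibre*w≤w ⟩
        sumℕ w                                ∎
        where
        open ≤-Reasoning
        fibre*w≤w : ∀ j → fibre j * w j ≤ w j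
        fibre*w≤w j = ≤-trans (*-monoˡ-≤ (w j) (fibre≤1 j)) (≤-reflexive (*-identityˡ (w j)))

      sumℕ-pullback-≡ : ∀ w → (∀ j → w j ≢ 0 → ∃ λ i → S i × κ i ≡ j) → sumℕ (pullback S? w) ≡ sumℕ w
      sumℕ-pullback-≡ w w⊆κS = begin
        sumℕ (pullback S? w)                  ≡⟨ sumℕ-pushforward (pullback S? w) ⟨
        sumℕ (pushforward κ (pullback S? w))  ≡⟨ sumℕ-cong (pushforward-pullback w) ⟩
        sumℕ (λ j → fibre j * w j)            ≡⟨ sumℕ-cong fibre*w≡w ⟩
        sumℕ w                                ∎
        where
        open ≡-Reasoning
        fibre*w≡w : ∀ j → fibre j * w j ≡ w j
        fibre*w≡w j with w j ℕ.≟ 0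
        ... | yes wⱼ≡0 = trans (cong (fibre j *_) wⱼ≡0) (trans (*-zeroʳ (fibre j)) (sym wⱼ≡0))
        ... | no wⱼ≢0 with w⊆κS j wⱼ≢0
        ...   | i , Sᵢ , refl =
          trans (cong (_* w j) (≤-antisym (fibre≤1 j) (1≤fibre Sᵢ))) (*-identityˡ (w j))

  sumℕ-∘-injective-≤ : ∀ {m n} (κ : Fin m → Fin n) → (∀ {i i′} → κ i ≡ κ i′ → i ≡ i′) →
                       (w : Fin n → ℕ) → sumℕ (w ∘ κ) ≤ sumℕ w
  sumℕ-∘-injective-≤ κ κ-injective w =
    ≤-trans (≤-reflexive (sumℕ-cong (λ i → sym (*-identityˡ (w (κ i))))))
            (sumℕ-pullback-≤ κ (λ _ → yes tt) (λ _ _ → κ-injective) w)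

-- Walks and balls

module _ (G : Graph) where
  open import Data.Nat.Base using (_+_; _≤_)
  open import Data.Nat.Properties
  open import Relation.Nullary.Decidable using (_×-dec_)
  import Data.Bool.Properties as Bool

  private
    Vertex = Fin (size G)

  within-≤ : ∀ {k k′} {x y : Vertex} → k ≤ k′ → Within G k x y → Within G k′ x y
  within-≤ _          here       = here
  within-≤ (s≤s k≤k′) (step e w) = step e (within-≤ k≤k′ w)

  within-trans : ∀ {a b} {x y z : Vertex} → Within G a x y → Within G b y z → Within G (a + b) x z
  within-trans {a} {b} here w′ = within-≤ (m≤n+m b a) w′
  within-trans (step e w) w′ = step e (within-trans w w′)

  within-snoc : ∀ {k} {x y z : Vertex} → Within G k x y → adj G y z ≡ true → Within G (suc k) x z
  within-snoc here       e′ = step e′ here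
  within-snoc (step e w) e′ = step e (within-snoc w e′)

  within-sym : ∀ {k} {x y : Vertex} → Within G k x y → Within G k y x
  within-sym here                        = here
  within-sym {x = x} (step {z = z} e w) = within-snoc (within-sym w) (trans (Graph.sym G z x) e)

  within-zero⇒≡ : ∀ {x y : Vertex} → Within G 0 x y → x ≡ y
  within-zero⇒≡ here = refl

  within-suc⁻¹ : ∀ {k} {x y : Vertex} → Within G (suc k) x y →
                 x ≡ y ⊎ ∃ λ z → adj G x z ≡ true × Within G k z y
  within-suc⁻¹ here       = inj₁ refl
  within-suc⁻¹ (step e w) = inj₂ (_ , e , w)

  within? : ∀ k (x y : Vertex) → Dec (Within G k x y)
  within? k x y with x Fin.≟ y
  ... | yes refl = yes here
  within? zero    x y | no x≢y = no (x≢y ∘ within-zero⇒≡)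
  within? (suc k) x y | no x≢y
    with Fin.any? (λ z → (adj G x z Bool.≟ true) ×-dec within? k z y)
  ... | yes (z , e , w) = yes (step e w)
  ... | no ¬path        = no λ w → [ x≢y , ¬path ]′ (within-suc⁻¹ w)

  ballSize : ℕ → Vertex → ℕ
  ballSize k x = sumℕ (λ y → 𝟙 (within? k x y))

ballBound : ℕ → ℕ → ℕ
ballBound d zero    = 1
ballBound d (suc k) = suc (d ℕ.* ballBound d k)

module _ {d} (G : Graph) (maxDeg : MaxDeg≤ d G) where
  open import Data.Nat.Base using (_+_; _*_; _≤_; _<_)
  open import Data.Nat.Properties

  private
    Vertex = Fin (size G)

    edge : Vertex → Vertex → ℕ
    edge x z = if adj G x z then 1 else 0

  𝟙-within-suc≤ : ∀ k (x y : Vertex) →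
    𝟙 (within? G (suc k) x y) ≤ 𝟙 (x Fin.≟ y) + sumℕ (λ z → edge x z * 𝟙 (within? G k z y))
  𝟙-within-suc≤ k x y with within? G (suc k) x y
  ... | no _ = z≤n
  ... | yes w with within-suc⁻¹ G w
  ...   | inj₁ x≡y = ≤-trans (≤-reflexive (sym (𝟙-yes (x Fin.≟ y) x≡y))) (m≤m+n _ _)
  ...   | inj₂ (z , e , w′) =
    ≤-trans (≤-trans (≤-reflexive (sym termᶻ≡1)) (≤-sumℕ neighbours z)) (m≤n+m _ _)
    where
    neighbours : Vertex → ℕ
    neighbours v = edge x v * 𝟙 (within? G k v y)
    termᶻ≡1 : neighbours z ≡ 1
    termᶻ≡1 rewrite e | 𝟙-yes (within? G k z y) w′ = refl

  ballSize≤ballBound : ∀ k (x : Vertex) → ballSize G k x ≤ ballBound d k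
  ballSize≤ballBound zero x =
    ≤-reflexive (trans (sumℕ-single _ x outside-x) (𝟙-yes (within? G 0 x x) here))
    where
    outside-x : ∀ y → y ≢ x → 𝟙 (within? G 0 x y) ≡ 0
    outside-x y y≢x = 𝟙-no (within? G 0 x y) (y≢x ∘ sym ∘ within-zero⇒≡ G)
  ballSize≤ballBound (suc k) x = begin
    ballSize G (suc k) x
      ≤⟨ sumℕ-mono (𝟙-within-suc≤ k x) ⟩
    sumℕ (λ y → 𝟙 (x Fin.≟ y) + sumℕ (λ z → edge x z * 𝟙 (within? G k z y)))
      ≡⟨ sumℕ-+ (λ y → 𝟙 (x Fin.≟ y)) (λ y → sumℕ (λ z → edge x z * 𝟙 (within? G k z y))) ⟩
    sumℕ (λ y → 𝟙 (x Fin.≟ y)) + sumℕ (λ y → sumℕ (λ z → edge x z * 𝟙 (within? G k z y)))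
      ≡⟨ cong₂ _+_ (sumℕ-𝟙-≟ x) (trans (sumℕ-comm (λ y z → edge x z * 𝟙 (within? G k z y)))
                                      (sumℕ-cong (λ z → sumℕ-*ˡ (edge x z) (λ y → 𝟙 (within? G k z y))))) ⟩
    1 + sumℕ (λ z → edge x z * ballSize G k z)
      ≤⟨ +-monoʳ-≤ 1 (sumℕ-mono (λ z → *-monoʳ-≤ (edge x z) (ballSize≤ballBound k z))) ⟩
    1 + sumℕ (λ z → edge x z * ballBound d k)
      ≡⟨ cong suc (sumℕ-*ʳ (edge x) (ballBound d k)) ⟩
    1 + degree G x * ballBound d k
      ≤⟨ +-monoʳ-≤ 1 (*-monoˡ-≤ (ballBound d k) (maxDeg x)) ⟩
    ballBound d (suc k)
      ∎
    where open ≤-Reasoning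

  -- Distance colourings

  module _ (D : ℕ) where
    open import Relation.Nullary.Decidable using (_×-dec_)

    private
      C : ℕ
      C = suc (ballBound d D)

    freeColour : (col : Vertex → Fin C) (v : Vertex) → ∃ λ c → ∀ {u} → Within G D v u → col u ≢ c
    freeColour col v =
      let c , unused = Fin.¬∀⟶∃¬ C Used Used? notAllUsed in c , λ w e → unused (_ , w , e)
      where
      Used : Fin C → Set
      Used c = ∃ λ u → Within G D v u × col u ≡ c

      Used? : ∀ c → Dec (Used c)
      Used? c = Fin.any? (λ u → within? G D v u ×-dec (col u Fin.≟ c))

      inBall : Vertex → ℕ
      inBall u = 𝟙 (within? G D v u)

      notAllUsed : ¬ (∀ c → Used c)
      notAllUsed allUsed = 1+n≰n (begin
        C                                    ≡⟨ sumℕ-one C ⟨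
        sumℕ {C} (λ _ → 1)                   ≤⟨ sumℕ-mono 1≤pushforward ⟩
        sumℕ (pushforward col inBall)        ≡⟨ sumℕ-pushforward col inBall ⟩
        ballSize G D v                       ≤⟨ ballSize≤ballBound D v ⟩
        ballBound d D                        ∎)
        where
        open ≤-Reasoning
        1≤pushforward : ∀ c → 1 ≤ pushforward col inBall c
        1≤pushforward c with allUsed c
        ... | u , w , refl = ≤-trans (≤-reflexive (sym (𝟙-yes (within? G D v u) w)))
                                     (≤-pushforward col inBall u)

    private
      ProperBelow : ℕ → (Vertex → Fin C) → Set
      ProperBelow k col = ∀ {u v} → toℕ u < k → toℕ v < k → Within G D u v → col u ≡ col v → u ≡ v

      <-suc-≢ : ∀ {k} (k<n : k < size G) {u : Vertex} → toℕ u < suc k → u ≢ Fin.fromℕ< k<n → toℕ u < k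
      <-suc-≢ k<n u<1+k u≢k = ≤∧≢⇒< (≤-pred u<1+k)
        (λ u≡k → u≢k (Fin.toℕ-injective (trans u≡k (sym (Fin.toℕ-fromℕ< k<n)))))

      colourBelow : ∀ k → k ≤ size G → Σ (Vertex → Fin C) (ProperBelow k)
      colourBelow zero    _   = (λ _ → zero) , λ ()
      colourBelow (suc k) k<n with colourBelow k (<⇒≤ k<n)
      ... | col , proper with freeColour col (Fin.fromℕ< k<n)
      ...   | c , c-free = col′ , proper′
        where
        v₀ = Fin.fromℕ< k<n

        recolour : ∀ {u} → Dec (u ≡ v₀) → Fin C
        recolour (yes _)     = c
        recolour {u} (no _) = col u

        col′ : Vertex → Fin C
        col′ u = recolour (u Fin.≟ v₀)

        proper′ : ProperBelow (suc k) col′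
        proper′ {u} {v} u<1+k v<1+k w e with u Fin.≟ v₀ | v Fin.≟ v₀
        ... | yes u≡v₀ | yes v≡v₀ = trans u≡v₀ (sym v≡v₀)
        ... | yes refl | no _     = ⊥-elim (c-free w (sym e))
        ... | no _     | yes refl = ⊥-elim (c-free (within-sym G w) e)
        ... | no u≢v₀  | no v≢v₀  = proper (<-suc-≢ k<n u<1+k u≢v₀) (<-suc-≢ k<n v<1+k v≢v₀) w e

    distanceColouring : Σ (Vertex → Fin C) λ col → ∀ {u v} → Within G D u v → col u ≡ col v → u ≡ v
    distanceColouring =
      let col , proper = colourBelow (size G) ≤-refl in col , proper (Fin.toℕ<n _) (Fin.toℕ<n _)

-- Induced balls

record Enumeration {n} (P : Fin n → Set) : Set where
  field
    count          : ℕ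
    elem           : Fin count → Fin n
    elem-injective : ∀ {i j} → elem i ≡ elem j → i ≡ j
    elem-∈         : ∀ i → P (elem i)
    elem-onto      : ∀ y → P y → ∃ λ i → elem i ≡ y

enumerate : ∀ {n} {P : Fin n → Set} → (∀ y → Dec (P y)) → Enumeration P
enumerate {zero}  P? = record
  { count = 0 ; elem = λ () ; elem-injective = λ {i} → ⊥-elim (Fin.¬Fin0 i)
  ; elem-∈ = λ () ; elem-onto = λ () }
enumerate {suc n} {P} P? with enumerate (P? ∘ suc) | P? zero
... | E | no ¬P₀ = record
  { count = count ; elem = suc ∘ elem ; elem-injective = elem-injective ∘ Fin.suc-injective
  ; elem-∈ = elem-∈ ; elem-onto = onto }
  where
  open Enumeration E
  onto : ∀ y → P y → ∃ λ i → suc (elem i) ≡ y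
  onto zero    P₀ = ⊥-elim (¬P₀ P₀)
  onto (suc y) Pʸ = let i , eᵢ≡y = elem-onto y Pʸ in i , cong suc eᵢ≡y
... | E | yes P₀ = record
  { count = suc count ; elem = elem′ ; elem-injective = injective′
  ; elem-∈ = ∈′ ; elem-onto = onto }
  where
  open Enumeration E
  elem′ : Fin (suc count) → Fin (suc n)
  elem′ zero    = zero
  elem′ (suc i) = suc (elem i)
  injective′ : ∀ {i j} → elem′ i ≡ elem′ j → i ≡ j
  injective′ {zero}  {zero}  _ = refl
  injective′ {suc i} {suc j} e = cong suc (elem-injective (Fin.suc-injective e))
  ∈′ : ∀ i → P (elem′ i)
  ∈′ zero    = P₀
  ∈′ (suc i) = elem-∈ i
  onto : ∀ y → P y → ∃ λ i → elem′ i ≡ y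
  onto zero    _  = zero , refl
  onto (suc y) Pʸ = let i , eᵢ≡y = elem-onto y Pʸ in suc i , cong suc eᵢ≡y

module _ {G H : Graph} (φ : Fin (size H) → Fin (size G))
         (φ-adj : ∀ i j → adj H i j ≡ adj G (φ i) (φ j)) where
  open import Data.Nat.Base using (_≤_)
  open import Data.Nat.Properties using (≤-trans; n≤1+n)

  within-map : ∀ {k i j} → Within H k i j → Within G k (φ i) (φ j)
  within-map here                        = here
  within-map (step {x = i} {z = i′} e w) = step (trans (sym (φ-adj i i′)) e) (within-map w)

  module _ {s} {x} (φ-onto : ∀ y → Within G s x y → ∃ λ i → φ i ≡ y) {ρ} (φ-root : φ ρ ≡ x) where

    within-lift : ∀ {k z} → k ≤ s → Within G k z x → ∃ λ i → φ i ≡ z × Within H k i ρ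
    within-lift _ here = ρ , φ-root , here
    within-lift {suc k} {z} k+1≤s (step {z = z′} e w)
      with within-lift (≤-trans (n≤1+n k) k+1≤s) w | φ-onto z (within-≤ G k+1≤s (within-sym G (step e w)))
    ... | i′ , refl , w′ | i , refl = i , refl , step (trans (φ-adj i i′) e) w′

isBall-fromIso : ∀ {q d G T s x} {B : LRGraph q} → MaxDeg≤ d G → IsoToBall G T s x B → IsBall s d B
isBall-fromIso {d = d} {G} {s = s} {B = B} maxDeg
               (φ , φ-injective , φ-within , φ-onto , φ-adj , _ , φ-root) = maxDegB , withinB
  where
  open import Data.Nat.Properties using (≤-trans; ≤-reflexive; ≤-refl)

  maxDegB : MaxDeg≤ d (graph B)
  maxDegB i = ≤-trans (≤-reflexive (sumℕ-cong (λ j → cong (λ b → if b then 1 else 0) (φ-adj i j))))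
                      (≤-trans (sumℕ-∘-injective-≤ φ φ-injective (λ z → if adj G (φ i) z then 1 else 0))
                               (maxDeg (φ i)))

  withinB : ∀ i → Within (graph B) s (root B) i
  withinB i with within-lift φ φ-adj φ-onto φ-root ≤-refl (within-sym G (φ-within i))
  ... | j , φj≡φi , w =
    subst (Within (graph B) s (root B)) (φ-injective φj≡φi) (within-sym (graph B) w)

module _ {q} (G : Graph) (T : Fin (size G) → Fin q) (s : ℕ) (x : Fin (size G)) where
  open Enumeration (enumerate (within? G s x))

  ball : LRGraph q
  ball = record
    { graph = record
      { size  = count
      ; adj   = λ i j → adj G (elem i) (elem j)
      ; sym   = λ i j → Graph.sym G (elem i) (elem j)
      ; irref = λ i → irref G (elem i) }
    ; label = T ∘ elem
    ; root  = proj₁ (elem-onto x here) }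

  ball-iso : IsoToBall G T s x ball
  ball-iso = elem , elem-injective , elem-∈ , elem-onto , (λ _ _ → refl) , (λ _ → refl)
           , proj₂ (elem-onto x here)

-- Rationals

module _ where
  import Data.Integer.Base as ℤ
  import Data.Integer.Properties as ℤ
  import Data.Rational.Unnormalised.Base as ℚᵘ
  import Data.Rational.Unnormalised.Properties as ℚᵘ
  open import Data.Rational.Base using (_+_; _*_; _-_; -_; ∣_∣; _≤_; _<_)
  open import Data.Rational.Properties
  open import Data.Rational.Solver using (module +-*-Solver)
  open +-*-Solver using (solve; _:=_; _:+_; _:-_; _:*_; :-_)

  fromℕ : ℕ → ℚ
  fromℕ zero    = 0ℚ
  fromℕ (suc n) = 1ℚ + fromℕ n

  fromℕ-+ : ∀ a b → fromℕ (a ℕ.+ b) ≡ fromℕ a + fromℕ b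
  fromℕ-+ zero    b = sym (+-identityˡ (fromℕ b))
  fromℕ-+ (suc a) b = trans (cong (1ℚ +_) (fromℕ-+ a b)) (sym (+-assoc 1ℚ (fromℕ a) (fromℕ b)))

  0<1 : 0ℚ < 1ℚ
  0<1 = ℚ.*<* (ℤ.+<+ (s≤s z≤n))

  0≤fromℕ : ∀ a → 0ℚ ≤ fromℕ a
  0≤fromℕ zero    = ≤-refl
  0≤fromℕ (suc a) = +-mono-≤ (<⇒≤ 0<1) (0≤fromℕ a)

  fromℕ-mono-≤ : ∀ {a b} → a ℕ.≤ b → fromℕ a ≤ fromℕ b
  fromℕ-mono-≤ {a} {b} a≤b = begin
    fromℕ a                   ≡⟨ +-identityʳ (fromℕ a) ⟨
    fromℕ a + 0ℚ              ≤⟨ +-monoʳ-≤ (fromℕ a) (0≤fromℕ (b ℕ.∸ a)) ⟩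
    fromℕ a + fromℕ (b ℕ.∸ a) ≡⟨ fromℕ-+ a (b ℕ.∸ a) ⟨
    fromℕ (a ℕ.+ (b ℕ.∸ a))   ≡⟨ cong fromℕ (ℕ.m+[n∸m]≡n a≤b) ⟩
    fromℕ b                   ∎
    where open ≤-Reasoning

  fromℕ-mono-< : ∀ {a b} → a ℕ.< b → fromℕ a < fromℕ b
  fromℕ-mono-< {a} {suc b} (s≤s a≤b) = begin-strict
    fromℕ a      ≡⟨ +-identityˡ (fromℕ a) ⟨
    0ℚ + fromℕ a <⟨ +-monoˡ-< (fromℕ a) 0<1 ⟩
    1ℚ + fromℕ a ≤⟨ +-monoʳ-≤ 1ℚ (fromℕ-mono-≤ a≤b) ⟩
    fromℕ (suc b) ∎
    where open ≤-Reasoning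

  fromℕ-cancel-≤ : ∀ {a b} → fromℕ a ≤ fromℕ b → a ℕ.≤ b
  fromℕ-cancel-≤ {a} {b} fa≤fb with a ℕ.≤? b
  ... | yes a≤b = a≤b
  ... | no a≰b  = ⊥-elim (<-irrefl refl (<-≤-trans (fromℕ-mono-< (ℕ.≰⇒> a≰b)) fa≤fb))

  fromℕ-positive : ∀ n → .{{ℕ.NonZero n}} → ℚ.Positive (fromℕ n)
  fromℕ-positive (suc n) = ℚ.positive (fromℕ-mono-< {0} {suc n} (s≤s z≤n))

  fromℕ-∸ : ∀ {a b} → b ℕ.≤ a → fromℕ (a ℕ.∸ b) ≡ fromℕ a - fromℕ b
  fromℕ-∸ {a} {b} b≤a = begin
    fromℕ (a ℕ.∸ b)
      ≡⟨ solve 2 (λ x y → x := (y :+ x) :- y) refl (fromℕ (a ℕ.∸ b)) (fromℕ b) ⟩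
    (fromℕ b + fromℕ (a ℕ.∸ b)) - fromℕ b
      ≡⟨ cong (_- fromℕ b) (fromℕ-+ b (a ℕ.∸ b)) ⟨
    fromℕ (b ℕ.+ (a ℕ.∸ b)) - fromℕ b
      ≡⟨ cong (λ t → fromℕ t - fromℕ b) (ℕ.m+[n∸m]≡n b≤a) ⟩
    fromℕ a - fromℕ b
      ∎
    where open ≡-Reasoning

  ∣fromℕ-fromℕ∣ : ∀ a b → ∣ fromℕ a - fromℕ b ∣ ≡ fromℕ ℕ.∣ a - b ∣
  ∣fromℕ-fromℕ∣ a b with ℕ.≤-total a b
  ... | inj₁ a≤b = begin
    ∣ fromℕ a - fromℕ b ∣     ≡⟨ cong ∣_∣ (solve 2 (λ x y → x :- y := :- (y :- x)) refl (fromℕ a) (fromℕ b)) ⟩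
    ∣ - (fromℕ b - fromℕ a) ∣ ≡⟨ ∣-p∣≡∣p∣ (fromℕ b - fromℕ a) ⟩
    ∣ fromℕ b - fromℕ a ∣     ≡⟨ cong ∣_∣ (fromℕ-∸ a≤b) ⟨
    ∣ fromℕ (b ℕ.∸ a) ∣       ≡⟨ 0≤p⇒∣p∣≡p (0≤fromℕ (b ℕ.∸ a)) ⟩
    fromℕ (b ℕ.∸ a)           ≡⟨ cong fromℕ (ℕ.m≤n⇒∣m-n∣≡n∸m a≤b) ⟨
    fromℕ ℕ.∣ a - b ∣         ∎
    where open ≡-Reasoning
  ... | inj₂ b≤a = begin
    ∣ fromℕ a - fromℕ b ∣     ≡⟨ cong ∣_∣ (fromℕ-∸ b≤a) ⟨
    ∣ fromℕ (a ℕ.∸ b) ∣       ≡⟨ 0≤p⇒∣p∣≡p (0≤fromℕ (a ℕ.∸ b)) ⟩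
    fromℕ (a ℕ.∸ b)           ≡⟨ cong fromℕ (ℕ.m≤n⇒∣n-m∣≡n∸m b≤a) ⟨
    fromℕ ℕ.∣ a - b ∣         ∎
    where open ≡-Reasoning

  toℚᵘ-fromℕ : ∀ k → ℚ.toℚᵘ (fromℕ k) ℚᵘ.≃ ℚᵘ.mkℚᵘ (ℤ.+ k) 0
  toℚᵘ-fromℕ zero    = ℚᵘ.*≡* refl
  toℚᵘ-fromℕ (suc k) = ℚᵘ.≃-trans (toℚᵘ-homo-+ 1ℚ (fromℕ k))
                         (ℚᵘ.≃-trans (ℚᵘ.+-congʳ (ℚ.toℚᵘ 1ℚ) (toℚᵘ-fromℕ k)) (ℚᵘ.*≡* (eq (ℤ.+ k))))
    where
    eq : ∀ K → (ℤ.1ℤ ℤ.* ℤ.1ℤ ℤ.+ K ℤ.* ℤ.1ℤ) ℤ.* ℤ.1ℤ ≡ (ℤ.1ℤ ℤ.+ K) ℤ.* (ℤ.1ℤ ℤ.* ℤ.1ℤ)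
    eq K = trans (ℤ.*-identityʳ _) (trans (cong (λ k → ℤ.1ℤ ℤ.+ k) (ℤ.*-identityʳ K)) (sym (ℤ.*-identityʳ _)))

  archimedean : ∀ p → ∃ λ k → p ≤ fromℕ k
  archimedean (ℚ.mkℚ (ℤ.+ n) _ _) =
    n , toℚᵘ-cancel-≤ (ℚᵘ.≤-respʳ-≃ (ℚᵘ.≃-sym (toℚᵘ-fromℕ n))
                        (ℚᵘ.*≤* (ℤ.*-monoˡ-≤-nonNeg (ℤ.+ n) (ℤ.+≤+ (s≤s z≤n)))))
  archimedean (ℚ.mkℚ ℤ.-[1+ _ ] _ _) = 0 , ℚ.*≤* ℤ.-≤+

  archimedean-* : ∀ K δ → 0ℚ < δ → ∃ λ N → fromℕ K ≤ fromℕ (suc N) * δ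
  archimedean-* K δ 0<δ = N , (begin
    fromℕ K                     ≡⟨ *-identityʳ (fromℕ K) ⟨
    fromℕ K * 1ℚ                ≡⟨ cong (fromℕ K *_) (*-inverseˡ δ) ⟨
    fromℕ K * (1/δ * δ)         ≡⟨ *-assoc (fromℕ K) 1/δ δ ⟨
    fromℕ K * 1/δ * δ           ≤⟨ *-monoʳ-≤-nonNeg δ (≤-trans K/δ≤N (fromℕ-mono-≤ (ℕ.n≤1+n N))) ⟩
    fromℕ (suc N) * δ           ∎)
    where
    open ≤-Reasoning
    instance
      δ-positive : ℚ.Positive δ
      δ-positive = ℚ.positive 0<δ
      δ-nonZero : ℚ.NonZero δ
      δ-nonZero = pos⇒nonZero δ
      δ-nonNegative : ℚ.NonNegative δ
      δ-nonNegative = pos⇒nonNeg δ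
    1/δ = ℚ.1/ δ
    N = proj₁ (archimedean (fromℕ K * 1/δ))
    K/δ≤N = proj₂ (archimedean (fromℕ K * 1/δ))

  p<q⇒0<q-p : ∀ {p q} → p < q → 0ℚ < q - p
  p<q⇒0<q-p {p} p<q = ≤-<-trans (≤-reflexive (sym (+-inverseʳ p))) (+-monoˡ-< (- p) p<q)

  floorUpTo : ℕ → ℚ → ℕ
  floorUpTo zero    p = 0
  floorUpTo (suc n) p with fromℕ (suc n) ≤? p
  ... | yes _ = suc n
  ... | no _  = floorUpTo n p

  floorUpTo≤ : ∀ n {p} → 0ℚ ≤ p → fromℕ (floorUpTo n p) ≤ p
  floorUpTo≤ zero    0≤p = 0≤p
  floorUpTo≤ (suc n) {p} 0≤p with fromℕ (suc n) ≤? p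
  ... | yes n+1≤p = n+1≤p
  ... | no _      = floorUpTo≤ n 0≤p

  <floorUpTo+1 : ∀ n {p} → p < fromℕ (suc n) → p < fromℕ (suc (floorUpTo n p))
  <floorUpTo+1 zero    p<1   = p<1
  <floorUpTo+1 (suc n) {p} p<n+2 with fromℕ (suc n) ≤? p
  ... | yes _     = p<n+2
  ... | no n+1≰p  = <floorUpTo+1 n (≰⇒> n+1≰p)

  floorUpTo-0 : ∀ n → floorUpTo n 0ℚ ≡ 0
  floorUpTo-0 zero = refl
  floorUpTo-0 (suc n) with fromℕ (suc n) ≤? 0ℚ
  ... | yes n+1≤0 = ⊥-elim (<-irrefl refl (<-≤-trans (fromℕ-mono-< {0} {suc n} (s≤s z≤n)) n+1≤0))
  ... | no _      = floorUpTo-0 n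

  sumℚ-cong : ∀ {n} {f g : Fin n → ℚ} → (∀ i → f i ≡ g i) → sumℚ f ≡ sumℚ g
  sumℚ-cong {zero}  f≗g = refl
  sumℚ-cong {suc n} f≗g = cong₂ _+_ (f≗g zero) (sumℚ-cong (f≗g ∘ suc))

  sumℚ-mono : ∀ {n} {f g : Fin n → ℚ} → (∀ i → f i ≤ g i) → sumℚ f ≤ sumℚ g
  sumℚ-mono {zero}  f≤g = ≤-refl
  sumℚ-mono {suc n} f≤g = +-mono-≤ (f≤g zero) (sumℚ-mono (f≤g ∘ suc))

  sumℚ-+ : ∀ {n} (f g : Fin n → ℚ) → sumℚ (λ i → f i + g i) ≡ sumℚ f + sumℚ g
  sumℚ-+ {zero}  f g = sym (+-identityʳ 0ℚ)
  sumℚ-+ {suc n} f g = trans (cong (f zero + g zero +_) (sumℚ-+ (f ∘ suc) (g ∘ suc)))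
                             (solve 4 (λ a b c d → (a :+ b) :+ (c :+ d) := (a :+ c) :+ (b :+ d)) refl
                                    (f zero) (g zero) (sumℚ (f ∘ suc)) (sumℚ (g ∘ suc)))

  sumℚ-neg : ∀ {n} (f : Fin n → ℚ) → sumℚ (λ i → - f i) ≡ - sumℚ f
  sumℚ-neg {zero}  f = refl
  sumℚ-neg {suc n} f = trans (cong (- f zero +_) (sumℚ-neg (f ∘ suc))) (sym (neg-distrib-+ (f zero) _))

  sumℚ-- : ∀ {n} (f g : Fin n → ℚ) → sumℚ (λ i → f i - g i) ≡ sumℚ f - sumℚ g
  sumℚ-- f g = trans (sumℚ-+ f (λ i → - g i)) (cong (sumℚ f +_) (sumℚ-neg g))

  sumℚ-*ˡ : ∀ {n} (c : ℚ) (f : Fin n → ℚ) → sumℚ (λ i → c * f i) ≡ c * sumℚ f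
  sumℚ-*ˡ {zero}  c f = sym (*-zeroʳ c)
  sumℚ-*ˡ {suc n} c f = trans (cong (c * f zero +_) (sumℚ-*ˡ c (f ∘ suc))) (sym (*-distribˡ-+ c (f zero) _))

  sumℚ-fromℕ : ∀ {n} (f : Fin n → ℕ) → sumℚ (λ i → fromℕ (f i)) ≡ fromℕ (sumℕ f)
  sumℚ-fromℕ {zero}  f = refl
  sumℚ-fromℕ {suc n} f = trans (cong (fromℕ (f zero) +_) (sumℚ-fromℕ (f ∘ suc))) (sym (fromℕ-+ (f zero) _))

  0≤sumℚ : ∀ {n} (f : Fin n → ℚ) → (∀ i → 0ℚ ≤ f i) → 0ℚ ≤ sumℚ f
  0≤sumℚ {zero}  f 0≤f = ≤-refl
  0≤sumℚ {suc n} f 0≤f = +-mono-≤ (0≤f zero) (0≤sumℚ (f ∘ suc) (0≤f ∘ suc))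

  ≤-sumℚ : ∀ {n} (f : Fin n → ℚ) → (∀ i → 0ℚ ≤ f i) → ∀ k → f k ≤ sumℚ f
  ≤-sumℚ f 0≤f zero    = ≤-trans (≤-reflexive (sym (+-identityʳ (f zero))))
                                 (+-monoʳ-≤ (f zero) (0≤sumℚ (f ∘ suc) (0≤f ∘ suc)))
  ≤-sumℚ f 0≤f (suc k) = ≤-trans (≤-sumℚ (f ∘ suc) (0≤f ∘ suc) k)
                                 (≤-trans (≤-reflexive (sym (+-identityˡ _))) (+-monoˡ-≤ _ (0≤f zero)))

  ∣p+r-q∣≤q-p+r : ∀ p q r → p ≤ q → 0ℚ ≤ r → ∣ p + r - q ∣ ≤ q - p + r
  ∣p+r-q∣≤q-p+r p q r p≤q 0≤r = begin
    ∣ p + r - q ∣         ≡⟨ cong ∣_∣ (solve 3 (λ p q r → p :+ r :- q := r :- (q :- p)) refl p q r) ⟩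
    ∣ r - (q - p) ∣       ≤⟨ ∣p-q∣≤∣p∣+∣q∣ r (q - p) ⟩
    ∣ r ∣ + ∣ q - p ∣     ≡⟨ cong₂ _+_ (0≤p⇒∣p∣≡p 0≤r) (0≤p⇒∣p∣≡p 0≤q-p) ⟩
    r + (q - p)           ≡⟨ +-comm r (q - p) ⟩
    q - p + r             ∎
    where
    open ≤-Reasoning
    0≤q-p : 0ℚ ≤ q - p
    0≤q-p = ≤-trans (≤-reflexive (sym (+-inverseʳ p))) (+-monoˡ-≤ (- p) p≤q)

  sumℚ-∣fromℕ-fromℕ∣ : ∀ {n} (a b : Fin n → ℕ) →
                       dist₁ (fromℕ ∘ a) (fromℕ ∘ b) ≡ fromℕ (sumℕ (λ z → ℕ.∣ a z - b z ∣))
  sumℚ-∣fromℕ-fromℕ∣ a b =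
    trans (sumℚ-cong (λ z → ∣fromℕ-fromℕ∣ (a z) (b z))) (sumℚ-fromℕ (λ z → ℕ.∣ a z - b z ∣))

  dist₁-triangle₃ : ∀ {n} (a b c e : Fin n → ℚ) → dist₁ a e ≤ dist₁ a b + dist₁ b c + dist₁ e c
  dist₁-triangle₃ a b c e = begin
    dist₁ a e
      ≤⟨ sumℚ-mono pointwise ⟩
    sumℚ (λ z → ∣ a z - b z ∣ + ∣ b z - c z ∣ + ∣ e z - c z ∣)
      ≡⟨ sumℚ-+ (λ z → ∣ a z - b z ∣ + ∣ b z - c z ∣) (λ z → ∣ e z - c z ∣) ⟩
    sumℚ (λ z → ∣ a z - b z ∣ + ∣ b z - c z ∣) + dist₁ e c
      ≡⟨ cong (_+ dist₁ e c) (sumℚ-+ (λ z → ∣ a z - b z ∣) (λ z → ∣ b z - c z ∣)) ⟩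
    dist₁ a b + dist₁ b c + dist₁ e c
      ∎
    where
    open ≤-Reasoning
    pointwise : ∀ z → ∣ a z - e z ∣ ≤ ∣ a z - b z ∣ + ∣ b z - c z ∣ + ∣ e z - c z ∣
    pointwise z = begin
      ∣ a z - e z ∣
        ≡⟨ cong ∣_∣ (solve 4 (λ a b c e → a :- e := (a :- b) :+ (b :- c) :- (e :- c)) refl
                            (a z) (b z) (c z) (e z)) ⟩
      ∣ (a z - b z) + (b z - c z) - (e z - c z) ∣
        ≤⟨ ∣p-q∣≤∣p∣+∣q∣ (a z - b z + (b z - c z)) (e z - c z) ⟩
      ∣ (a z - b z) + (b z - c z) ∣ + ∣ e z - c z ∣
        ≤⟨ +-monoˡ-≤ ∣ e z - c z ∣ (∣p+q∣≤∣p∣+∣q∣ (a z - b z) (b z - c z)) ⟩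
      ∣ a z - b z ∣ + ∣ b z - c z ∣ + ∣ e z - c z ∣
        ∎

  dist₁-*ˡ : ∀ {n} (c : ℚ) → 0ℚ ≤ c → (μ ν : Fin n → ℚ) →
             dist₁ (λ z → c * μ z) (λ z → c * ν z) ≡ c * dist₁ μ ν
  dist₁-*ˡ c 0≤c μ ν = trans (sumℚ-cong pointwise) (sumℚ-*ˡ c (λ z → ∣ μ z - ν z ∣))
    where
    pointwise : ∀ z → ∣ c * μ z - c * ν z ∣ ≡ c * ∣ μ z - ν z ∣
    pointwise z = begin
      ∣ c * μ z - c * ν z ∣
        ≡⟨ cong ∣_∣ (solve 3 (λ c x y → c :* x :- c :* y := c :* (x :- y)) refl c (μ z) (ν z)) ⟩
      ∣ c * (μ z - ν z) ∣
        ≡⟨ ∣p*q∣≡∣p∣*∣q∣ c (μ z - ν z) ⟩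
      ∣ c ∣ * ∣ μ z - ν z ∣
        ≡⟨ cong (_* ∣ μ z - ν z ∣) (0≤p⇒∣p∣≡p 0≤c) ⟩
      c * ∣ μ z - ν z ∣
        ∎
      where open ≡-Reasoning

  module _ (N : ℕ) .{{_ : ℕ.NonZero N}} where
    private
      instance
        N-positive : ℚ.Positive (fromℕ N)
        N-positive = fromℕ-positive N
        N-nonZero : ℚ.NonZero (fromℕ N)
        N-nonZero = pos⇒nonZero (fromℕ N)
        1/N-positive : ℚ.Positive (ℚ.1/ fromℕ N)
        1/N-positive = 1/pos⇒pos (fromℕ N)
        1/N-nonNegative : ℚ.NonNegative (ℚ.1/ fromℕ N)
        1/N-nonNegative = pos⇒nonNeg (ℚ.1/ fromℕ N)

      1/N : ℚ
      1/N = ℚ.1/ fromℕ N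

    normalise : ∀ {n} → (Fin n → ℕ) → Fin n → ℚ
    normalise m z = 1/N * fromℕ (m z)

    normalise-isProb : ∀ {n} (m : Fin n → ℕ) → sumℕ m ≡ N → IsProb (normalise m)
    normalise-isProb m Σm≡N = 0≤normalise , (begin
      sumℚ (normalise m)             ≡⟨ sumℚ-*ˡ 1/N (fromℕ ∘ m) ⟩
      1/N * sumℚ (fromℕ ∘ m)         ≡⟨ cong (1/N *_) (trans (sumℚ-fromℕ m) (cong fromℕ Σm≡N)) ⟩
      1/N * fromℕ N                  ≡⟨ *-inverseˡ (fromℕ N) ⟩
      1ℚ                             ∎)
      where
      open ≡-Reasoning
      0≤normalise : ∀ z → 0ℚ ≤ normalise m z
      0≤normalise z = ≤-trans (≤-reflexive (sym (*-zeroʳ 1/N))) (*-monoˡ-≤-nonNeg 1/N (0≤fromℕ (m z)))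

    normalise≢0⇒ : ∀ {n} (m : Fin n → ℕ) z → normalise m z ≢ 0ℚ → m z ≢ 0
    normalise≢0⇒ m z normalise≢0 m≡0 = normalise≢0 (trans (cong (λ k → 1/N * fromℕ k) m≡0) (*-zeroʳ 1/N))

    dist₁-normalise< : ∀ {n} (m m′ : Fin n → ℕ) {k ε} → sumℕ (λ z → ℕ.∣ m z - m′ z ∣) ℕ.≤ k →
                       fromℕ k < fromℕ N * ε → dist₁ (normalise m) (normalise m′) < ε
    dist₁-normalise< m m′ {k} {ε} Σ≤k k<Nε = begin-strict
      dist₁ (normalise m) (normalise m′)            ≡⟨ dist₁-*ˡ 1/N (nonNegative⁻¹ 1/N) (fromℕ ∘ m) (fromℕ ∘ m′) ⟩
      1/N * dist₁ (fromℕ ∘ m) (fromℕ ∘ m′)          ≡⟨ cong (1/N *_) (sumℚ-∣fromℕ-fromℕ∣ m m′) ⟩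
      1/N * fromℕ (sumℕ (λ z → ℕ.∣ m z - m′ z ∣))   ≤⟨ *-monoˡ-≤-nonNeg 1/N (fromℕ-mono-≤ Σ≤k) ⟩
      1/N * fromℕ k                                 <⟨ *-monoʳ-<-pos 1/N k<Nε ⟩
      1/N * (fromℕ N * ε)                           ≡⟨ *-assoc 1/N (fromℕ N) ε ⟨
      1/N * fromℕ N * ε                             ≡⟨ cong (_* ε) (*-inverseˡ (fromℕ N)) ⟩
      1ℚ * ε                                        ≡⟨ *-identityˡ ε ⟩
      ε                                             ∎
      where open ≤-Reasoning

-- Rounding probability vectors

supportSize : ∀ {n} → (Fin n → ℚ) → ℕ
supportSize μ = sumℕ (λ z → 𝟙 (¬? (μ z ℚ.≟ 0ℚ)))
  where open import Relation.Nullary.Decidable using (¬?)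

module _ {n} (N : ℕ) (μ : Fin n → ℚ) (x : Fin n) where
  open import Data.Rational.Base using (_+_; _*_; _-_; -_; ∣_∣; _≤_; _<_)
  open import Data.Rational.Properties
  open import Data.Rational.Solver using (module +-*-Solver)
  open +-*-Solver using (solve; _:=_; _:+_; _:-_; con)
  open import Relation.Nullary.Decidable using (¬?)

  private
    ⌊N*μ⌋ : Fin n → ℕ
    ⌊N*μ⌋ z = floorUpTo N (fromℕ N * μ z)

    deficit : ℕ
    deficit = N ℕ.∸ sumℕ ⌊N*μ⌋

  round : Fin n → ℕ
  round z = ⌊N*μ⌋ z ℕ.+ 𝟙 (x Fin.≟ z) ℕ.* deficit

  round≢0⇒ : ∀ z → round z ≢ 0 → x ≡ z ⊎ μ z ≢ 0ℚ
  round≢0⇒ z round≢0 with x Fin.≟ z | μ z ≟ 0ℚ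
  ... | yes x≡z | _       = inj₁ x≡z
  ... | no _    | no μ≢0 = inj₂ μ≢0
  ... | no _    | yes μ≡0 = ⊥-elim (round≢0 (begin
    ⌊N*μ⌋ z ℕ.+ 0                     ≡⟨ ℕ.+-identityʳ _ ⟩
    floorUpTo N (fromℕ N * μ z)       ≡⟨ cong (λ t → floorUpTo N (fromℕ N * t)) μ≡0 ⟩
    floorUpTo N (fromℕ N * 0ℚ)        ≡⟨ cong (floorUpTo N) (*-zeroʳ (fromℕ N)) ⟩
    floorUpTo N 0ℚ                    ≡⟨ floorUpTo-0 N ⟩
    0                                 ∎))
    where open ≡-Reasoning

  module _ (μ-prob : IsProb μ) where
    private
      instance
        N-nonNegative : ℚ.NonNegative (fromℕ N)
        N-nonNegative = ℚ.nonNegative (0≤fromℕ N)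

      N*μ : Fin n → ℚ
      N*μ z = fromℕ N * μ z

      0≤N*μ : ∀ z → 0ℚ ≤ N*μ z
      0≤N*μ z = ≤-trans (≤-reflexive (sym (*-zeroʳ (fromℕ N))))
                        (*-monoˡ-≤-nonNeg (fromℕ N) (proj₁ μ-prob z))

      N*μ≤N : ∀ z → N*μ z ≤ fromℕ N
      N*μ≤N z = ≤-trans (*-monoˡ-≤-nonNeg (fromℕ N) μ≤1) (≤-reflexive (*-identityʳ (fromℕ N)))
        where
        μ≤1 : μ z ≤ 1ℚ
        μ≤1 = subst (μ z ≤_) (proj₂ μ-prob) (≤-sumℚ μ (proj₁ μ-prob) z)

      sumℚ-N*μ : sumℚ N*μ ≡ fromℕ N
      sumℚ-N*μ = trans (sumℚ-*ˡ (fromℕ N) μ)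
                       (trans (cong (fromℕ N *_) (proj₂ μ-prob)) (*-identityʳ (fromℕ N)))

      ⌊N*μ⌋≤N*μ : ∀ z → fromℕ (⌊N*μ⌋ z) ≤ N*μ z
      ⌊N*μ⌋≤N*μ z = floorUpTo≤ N (0≤N*μ z)

      sumℕ-⌊N*μ⌋≤N : sumℕ ⌊N*μ⌋ ℕ.≤ N
      sumℕ-⌊N*μ⌋≤N = fromℕ-cancel-≤ (begin
        fromℕ (sumℕ ⌊N*μ⌋)           ≡⟨ sumℚ-fromℕ ⌊N*μ⌋ ⟨
        sumℚ (λ z → fromℕ (⌊N*μ⌋ z)) ≤⟨ sumℚ-mono ⌊N*μ⌋≤N*μ ⟩
        sumℚ N*μ                     ≡⟨ sumℚ-N*μ ⟩
        fromℕ N                      ∎)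
        where open ≤-Reasoning

      error : Fin n → ℚ
      error z = N*μ z - fromℕ (⌊N*μ⌋ z)

      error≤𝟙-support : ∀ z → error z ≤ fromℕ (𝟙 (¬? (μ z ≟ 0ℚ)))
      error≤𝟙-support z with μ z ≟ 0ℚ
      ... | yes μ≡0 = ≤-reflexive (begin
        fromℕ N * μ z - fromℕ (floorUpTo N (fromℕ N * μ z))
          ≡⟨ cong (λ t → t - fromℕ (floorUpTo N t)) N*μ≡0 ⟩
        0ℚ - fromℕ (floorUpTo N 0ℚ)
          ≡⟨ cong (λ k → 0ℚ - fromℕ k) (floorUpTo-0 N) ⟩
        0ℚ
          ∎)
        where
        open ≡-Reasoning
        N*μ≡0 : fromℕ N * μ z ≡ 0ℚ
        N*μ≡0 = trans (cong (fromℕ N *_) μ≡0) (*-zeroʳ (fromℕ N))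
      ... | no _ = <⇒≤ (begin-strict
        N*μ z - fromℕ (⌊N*μ⌋ z)
          <⟨ +-monoˡ-< (- fromℕ (⌊N*μ⌋ z)) N*μ<⌊N*μ⌋+1 ⟩
        fromℕ (suc (⌊N*μ⌋ z)) - fromℕ (⌊N*μ⌋ z)
          ≡⟨ solve 1 (λ k → (con 1ℚ :+ k) :- k := con 1ℚ) refl (fromℕ (⌊N*μ⌋ z)) ⟩
        1ℚ
          ∎)
        where
        open ≤-Reasoning
        N*μ<⌊N*μ⌋+1 : N*μ z < fromℕ (suc (⌊N*μ⌋ z))
        N*μ<⌊N*μ⌋+1 = <floorUpTo+1 N (≤-<-trans (N*μ≤N z) (fromℕ-mono-< (ℕ.n<1+n N)))

      sumℚ-error : sumℚ error ≡ fromℕ deficit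
      sumℚ-error = begin
        sumℚ error                                   ≡⟨ sumℚ-- N*μ (λ z → fromℕ (⌊N*μ⌋ z)) ⟩
        sumℚ N*μ - sumℚ (λ z → fromℕ (⌊N*μ⌋ z))      ≡⟨ cong₂ _-_ sumℚ-N*μ (sumℚ-fromℕ ⌊N*μ⌋) ⟩
        fromℕ N - fromℕ (sumℕ ⌊N*μ⌋)                 ≡⟨ fromℕ-∸ sumℕ-⌊N*μ⌋≤N ⟨
        fromℕ deficit                                ∎
        where open ≡-Reasoning

      sumℕ-𝟙*deficit : sumℕ (λ z → 𝟙 (x Fin.≟ z) ℕ.* deficit) ≡ deficit
      sumℕ-𝟙*deficit = trans (sumℕ-*ʳ (λ z → 𝟙 (x Fin.≟ z)) deficit)
                              (trans (cong (ℕ._* deficit) (sumℕ-𝟙-≟ x)) (ℕ.*-identityˡ deficit))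

    sumℕ-round : sumℕ round ≡ N
    sumℕ-round = begin
      sumℕ round                           ≡⟨ sumℕ-+ ⌊N*μ⌋ (λ z → 𝟙 (x Fin.≟ z) ℕ.* deficit) ⟩
      sumℕ ⌊N*μ⌋ ℕ.+ sumℕ (λ z → 𝟙 (x Fin.≟ z) ℕ.* deficit) ≡⟨ cong (sumℕ ⌊N*μ⌋ ℕ.+_) sumℕ-𝟙*deficit ⟩
      sumℕ ⌊N*μ⌋ ℕ.+ deficit               ≡⟨ ℕ.m+[n∸m]≡n sumℕ-⌊N*μ⌋≤N ⟩
      N                                    ∎
      where open ≡-Reasoning

    -- Each coordinate of ⌊N·μ⌋ loses less than 1 on the support of μ, and the mass put on x
    -- is the total loss.
    round-error : dist₁ (fromℕ ∘ round) (λ z → fromℕ N * μ z) ≤ fromℕ (2 ℕ.* supportSize μ)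
    round-error = begin
      sumℚ (λ z → ∣ fromℕ (round z) - N*μ z ∣)
        ≤⟨ sumℚ-mono pointwise ⟩
      sumℚ (λ z → error z + fromℕ (𝟙 (x Fin.≟ z) ℕ.* deficit))
        ≡⟨ sumℚ-+ error (λ z → fromℕ (𝟙 (x Fin.≟ z) ℕ.* deficit)) ⟩
      sumℚ error + sumℚ (λ z → fromℕ (𝟙 (x Fin.≟ z) ℕ.* deficit))
        ≡⟨ cong (sumℚ error +_) (trans (sumℚ-fromℕ (λ z → 𝟙 (x Fin.≟ z) ℕ.* deficit))
                                       (trans (cong fromℕ sumℕ-𝟙*deficit) (sym sumℚ-error))) ⟩
      sumℚ error + sumℚ error
        ≤⟨ +-mono-≤ sumℚ-error≤ sumℚ-error≤ ⟩
      fromℕ (supportSize μ) + fromℕ (supportSize μ)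
        ≡⟨ fromℕ-+ (supportSize μ) (supportSize μ) ⟨
      fromℕ (supportSize μ ℕ.+ supportSize μ)
        ≡⟨ cong (λ k → fromℕ (supportSize μ ℕ.+ k)) (ℕ.+-identityʳ (supportSize μ)) ⟨
      fromℕ (2 ℕ.* supportSize μ)
        ∎
      where
      open ≤-Reasoning
      pointwise : ∀ z → ∣ fromℕ (round z) - N*μ z ∣ ≤ error z + fromℕ (𝟙 (x Fin.≟ z) ℕ.* deficit)
      pointwise z = begin
        ∣ fromℕ (round z) - N*μ z ∣            ≡⟨ cong (λ t → ∣ t - N*μ z ∣) (fromℕ-+ (⌊N*μ⌋ z) d) ⟩
        ∣ fromℕ (⌊N*μ⌋ z) + fromℕ d - N*μ z ∣  ≤⟨ ∣p+r-q∣≤q-p+r _ _ _ (⌊N*μ⌋≤N*μ z) (0≤fromℕ d) ⟩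
        error z + fromℕ d                      ∎
        where d = 𝟙 (x Fin.≟ z) ℕ.* deficit
      sumℚ-error≤ : sumℚ error ≤ fromℕ (supportSize μ)
      sumℚ-error≤ = ≤-trans (sumℚ-mono error≤𝟙-support) (≤-reflexive (sumℚ-fromℕ (λ z → 𝟙 (¬? (μ z ≟ 0ℚ)))))

module _ {n} (N : ℕ) .{{_ : ℕ.NonZero N}} {μ ν : Fin n → ℚ} (μ-prob : IsProb μ) (ν-prob : IsProb ν) where
  open import Data.Rational.Base using (_+_; _*_; _-_; _≤_; _<_)
  open import Data.Rational.Properties
  open import Data.Rational.Solver using (module +-*-Solver)
  open +-*-Solver using (solve; _:=_; _:+_; _:-_; _:*_)

  private
    instance
      N-positive : ℚ.Positive (fromℕ N)
      N-positive = fromℕ-positive N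

  round-close : ∀ {K ε ε′} x y → supportSize μ ℕ.≤ K → supportSize ν ℕ.≤ K →
                fromℕ (4 ℕ.* K) ≤ fromℕ N * (ε′ - ε) → dist₁ μ ν < ε →
                fromℕ (sumℕ (λ z → ℕ.∣ round N μ x z - round N ν y z ∣)) < fromℕ N * ε′
  round-close {K} {ε} {ε′} x y μ≤K ν≤K N-large μν<ε = begin-strict
    fromℕ (sumℕ (λ z → ℕ.∣ round N μ x z - round N ν y z ∣))
      ≡⟨ sumℚ-∣fromℕ-fromℕ∣ (round N μ x) (round N ν y) ⟨
    dist₁ (fromℕ ∘ round N μ x) (fromℕ ∘ round N ν y)
      ≤⟨ dist₁-triangle₃ (fromℕ ∘ round N μ x) Nμ Nν (fromℕ ∘ round N ν y) ⟩
    dist₁ (fromℕ ∘ round N μ x) Nμ + dist₁ Nμ Nν + dist₁ (fromℕ ∘ round N ν y) Nν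
      <⟨ +-mono-<-≤ (+-mono-≤-< (round-error≤ μ μ-prob x μ≤K) Nμ-Nν<Nε) (round-error≤ ν ν-prob y ν≤K) ⟩
    fromℕ (2 ℕ.* K) + fromℕ N * ε + fromℕ (2 ℕ.* K)
      ≡⟨ solve 3 (λ a b c → a :+ b :+ c := (a :+ c) :+ b) refl (fromℕ (2 ℕ.* K)) (fromℕ N * ε) _ ⟩
    (fromℕ (2 ℕ.* K) + fromℕ (2 ℕ.* K)) + fromℕ N * ε
      ≡⟨ cong (_+ fromℕ N * ε) (trans (cong fromℕ (ℕ.*-distribʳ-+ K 2 2)) (fromℕ-+ (2 ℕ.* K) (2 ℕ.* K))) ⟨
    fromℕ (4 ℕ.* K) + fromℕ N * ε
      ≤⟨ +-monoˡ-≤ (fromℕ N * ε) N-large ⟩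
    fromℕ N * (ε′ - ε) + fromℕ N * ε
      ≡⟨ solve 3 (λ n e′ e → n :* (e′ :- e) :+ n :* e := n :* e′) refl (fromℕ N) ε′ ε ⟩
    fromℕ N * ε′
      ∎
    where
    open ≤-Reasoning
    Nμ Nν : Fin n → ℚ
    Nμ z = fromℕ N * μ z
    Nν z = fromℕ N * ν z

    round-error≤ : ∀ ρ → IsProb ρ → ∀ x → supportSize ρ ℕ.≤ K →
                   dist₁ (fromℕ ∘ round N ρ x) (λ z → fromℕ N * ρ z) ≤ fromℕ (2 ℕ.* K)
    round-error≤ ρ ρ-prob x ρ≤K = ≤-trans (round-error N ρ x ρ-prob) (fromℕ-mono-≤ (ℕ.*-monoʳ-≤ 2 ρ≤K))

    Nμ-Nν<Nε : dist₁ Nμ Nν < fromℕ N * ε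
    Nμ-Nν<Nε = ≤-<-trans (≤-reflexive (dist₁-*ˡ (fromℕ N) (0≤fromℕ N) μ ν)) (*-monoʳ-<-pos (fromℕ N) μν<ε)

-- The proof labelling scheme

module Scheme (d r N : ℕ) (ε′ : ℚ) where
  open import Data.Nat.Base using (_+_; _*_; _^_; ∣_-_∣)
  open import Data.Rational.Base using (_<_)

  s : ℕ
  s = suc r

  colours : ℕ
  colours = suc (ballBound d (s + s))

  Label : Set
  Label = Fin colours × (Fin colours → Fin (suc N))

  -- Opaque, so that the large numeral q is never unfolded.
  opaque
    q : ℕ
    q = colours * suc N ^ colours

    encode : Label → Fin q
    encode (c , w) = Fin.combine {colours} {suc N ^ colours} c (Fin.funToFin w)

    colour : Fin q → Fin colours
    colour t = proj₁ (Fin.remQuot {colours} (suc N ^ colours) t)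

    weight : Fin q → Fin colours → ℕ
    weight t = toℕ ∘ Fin.finToFun (proj₂ (Fin.remQuot {colours} (suc N ^ colours) t))

    colour-encode : ∀ c w → colour (encode (c , w)) ≡ c
    colour-encode c w = cong proj₁ (Fin.remQuot-combine {colours} {suc N ^ colours} c (Fin.funToFin w))

    weight-encode : ∀ c w c′ → weight (encode (c , w)) c′ ≡ toℕ (w c′)
    weight-encode c w c′ =
      cong toℕ (trans (cong (λ p → Fin.finToFun (proj₂ p) c′)
                            (Fin.remQuot-combine {colours} {suc N ^ colours} c (Fin.funToFin w)))
                      (Fin.finToFun-funToFin w c′))

  weightDist : Fin q → Fin q → ℕ
  weightDist t t′ = sumℕ (λ c → ∣ weight t c - weight t′ c ∣)

  record Valid (G : Graph) (L : Fin (size G) → Fin q) (x : Fin (size G)) : Set where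
    field
      colour-injective : ∀ {y z} → Within G s x y → Within G s x z → colour (L y) ≡ colour (L z) → y ≡ z
      weight-total     : sumℕ (weight (L x)) ≡ N
      weight-support   : ∀ c → weight (L x) c ≢ 0 → ∃ λ z → Within G r x z × colour (L z) ≡ c
      weight-close     : ∀ y → adj G x y ≡ true → fromℕ (weightDist (L x) (L y)) < fromℕ N ℚ.* ε′

  V : LRGraph q → Set
  V B = IsBall s d B × Valid (graph B) (label B) (root B)

  module _ {G : Graph} {T : Fin (size G) → Fin q} {x : Fin (size G)} {B : LRGraph q} where

    valid-fromBall : IsoToBall G T s x B → IsBall s d B →
                     Valid (graph B) (label B) (root B) → Valid G T x
    valid-fromBall (φ , _ , _ , φ-onto , φ-adj , φ-label , φ-root) (_ , withinB) v = record
      { colour-injective = colour-injective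
      ; weight-total     = subst (λ t → sumℕ (weight t) ≡ N) label-root (Valid.weight-total v)
      ; weight-support   = weight-support
      ; weight-close     = weight-close }
      where
      label-root : label B (root B) ≡ T x
      label-root = trans (φ-label (root B)) (cong T φ-root)

      colour-injective : ∀ {y z} → Within G s x y → Within G s x z → colour (T y) ≡ colour (T z) → y ≡ z
      colour-injective {y} {z} wʸ wᶻ e with φ-onto y wʸ | φ-onto z wᶻ
      ... | i , refl | j , refl = cong φ (Valid.colour-injective v (withinB i) (withinB j) colourᵢ≡colourⱼ)
        where
        colourᵢ≡colourⱼ : colour (label B i) ≡ colour (label B j)
        colourᵢ≡colourⱼ = trans (cong colour (φ-label i)) (trans e (cong colour (sym (φ-label j))))

      weight-support : ∀ c → weight (T x) c ≢ 0 → ∃ λ z → Within G r x z × colour (T z) ≡ c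
      weight-support c w≢0 with Valid.weight-support v c (subst (λ t → weight t c ≢ 0) (sym label-root) w≢0)
      ... | i , w , e = φ i , subst (λ t → Within G r t (φ i)) φ-root (within-map φ φ-adj w)
                            , trans (cong colour (sym (φ-label i))) e

      weight-close : ∀ y → adj G x y ≡ true → fromℕ (weightDist (T x) (T y)) < fromℕ N ℚ.* ε′
      weight-close y xy with φ-onto y (within-≤ G (s≤s z≤n) (step xy here))
      ... | j , refl = subst₂ (λ t t′ → fromℕ (weightDist t t′) < fromℕ N ℚ.* ε′) label-root (φ-label j)
                              (Valid.weight-close v j root~j)
        where
        root~j : adj (graph B) (root B) j ≡ true
        root~j = trans (φ-adj (root B) j) (trans (cong (λ t → adj G t (φ j)) φ-root) xy)

    valid-toBall : IsoToBall G T s x B → Valid G T x → Valid (graph B) (label B) (root B)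
    valid-toBall (φ , φ-injective , _ , φ-onto , φ-adj , φ-label , φ-root) v = record
      { colour-injective = colour-injective
      ; weight-total     = subst (λ t → sumℕ (weight t) ≡ N) (sym label-root) (Valid.weight-total v)
      ; weight-support   = weight-support
      ; weight-close     = weight-close }
      where
      label-root : label B (root B) ≡ T x
      label-root = trans (φ-label (root B)) (cong T φ-root)

      fromRoot : ∀ {k i} → Within (graph B) k (root B) i → Within G k x (φ i)
      fromRoot w = subst (λ t → Within G _ t _) φ-root (within-map φ φ-adj w)

      colour-injective : ∀ {i j} → Within (graph B) s (root B) i → Within (graph B) s (root B) j →
                         colour (label B i) ≡ colour (label B j) → i ≡ j
      colour-injective {i} {j} wⁱ wʲ e =
        φ-injective (Valid.colour-injective v (fromRoot wⁱ) (fromRoot wʲ) colourᵢ≡colourⱼ)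
        where
        colourᵢ≡colourⱼ : colour (T (φ i)) ≡ colour (T (φ j))
        colourᵢ≡colourⱼ = trans (cong colour (sym (φ-label i))) (trans e (cong colour (φ-label j)))

      weight-support : ∀ c → weight (label B (root B)) c ≢ 0 →
                       ∃ λ i → Within (graph B) r (root B) i × colour (label B i) ≡ c
      weight-support c w≢0 with Valid.weight-support v c (subst (λ t → weight t c ≢ 0) label-root w≢0)
      ... | z , w , e with within-lift φ φ-adj φ-onto φ-root (ℕ.n≤1+n r) (within-sym G w)
      ...   | i , refl , wB = i , within-sym (graph B) wB , trans (cong colour (φ-label i)) e

      weight-close : ∀ j → adj (graph B) (root B) j ≡ true →
                     fromℕ (weightDist (label B (root B)) (label B j)) < fromℕ N ℚ.* ε′
      weight-close j e = subst₂ (λ t t′ → fromℕ (weightDist t t′) < fromℕ N ℚ.* ε′)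
                                (sym label-root) (sym (φ-label j)) (Valid.weight-close v (φ j) x~φj)
        where
        x~φj : adj G x (φ j) ≡ true
        x~φj = trans (cong (λ t → adj G t (φ j)) (sym φ-root)) (trans (sym (φ-adj (root B) j)) e)

  accepts⇒valid : ∀ {G T} → Accepts V s G T → ∀ x → Valid G T x
  accepts⇒valid accepts x =
    let _ , (B-ball , B-valid) , iso = accepts x in valid-fromBall iso B-ball B-valid

  valid⇒accepts : ∀ {G T} → MaxDeg≤ d G → (∀ x → Valid G T x) → Accepts V s G T
  valid⇒accepts {G} {T} maxDeg valid x = ball G T s x , (ball-isBall , ball-valid) , ball-iso G T s x
    where
    ball-isBall : IsBall s d (ball G T s x)
    ball-isBall = isBall-fromIso {T = T} maxDeg (ball-iso G T s x)
    ball-valid : Valid (graph (ball G T s x)) (label (ball G T s x)) (root (ball G T s x))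
    ball-valid = valid-toBall (ball-iso G T s x) (valid x)

  module _ .{{_ : ℕ.NonZero N}} (H : Graph) (L : Fin (size H) → Fin q) (valid : ∀ x → Valid H L x) where
    open import Data.Nat.Base using (_≤_)
    open import Data.Nat.Properties using (*-distribˡ-∣-∣; ≤-trans; ≤-reflexive)

    private
      Vertex = Fin (size H)

      col : Vertex → Fin colours
      col z = colour (L z)

      w : Vertex → Fin colours → ℕ
      w x = weight (L x)

      Bᵣx⊆Bₛx : ∀ {x y} → Within H r x y → Within H s x y
      Bᵣx⊆Bₛx = within-≤ H (ℕ.n≤1+n r)

    decoded : Vertex → Vertex → ℕ
    decoded x z = 𝟙 (within? H r x z) * w x (col z)

    -- A colour with positive weight at u occurs in B_r(u) ⊆ B_s(x), where colours are injective.
    decoded≡pullback : ∀ {x u} → (∀ {y} → Within H r u y → Within H s x y) →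
                       ∀ z → decoded u z ≡ pullback col (within? H s x) (w u) z
    decoded≡pullback {x} {u} Bᵣu⊆Bₛx z with within? H s x z | within? H r u z
    ... | no z∉Bₛx | yes z∈Bᵣu = ⊥-elim (z∉Bₛx (Bᵣu⊆Bₛx z∈Bᵣu))
    ... | no _     | no _      = refl
    ... | yes _    | yes _     = refl
    ... | yes z∈Bₛx | no z∉Bᵣu with w u (col z) ℕ.≟ 0
    ...   | yes w≡0 = sym (cong (1 *_) w≡0)
    ...   | no w≢0 with Valid.weight-support (valid u) (col z) w≢0
    ...     | z′ , z′∈Bᵣu , e = ⊥-elim (z∉Bᵣu (subst (Within H r u) z′≡z z′∈Bᵣu))
      where
      z′≡z : z′ ≡ z
      z′≡z = Valid.colour-injective (valid x) (Bᵣu⊆Bₛx z′∈Bᵣu) z∈Bₛx e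

    sumℕ-decoded : ∀ x → sumℕ (decoded x) ≡ N
    sumℕ-decoded x = begin
      sumℕ (decoded x)                           ≡⟨ sumℕ-cong (decoded≡pullback {x} {x} Bᵣx⊆Bₛx) ⟩
      sumℕ (pullback col (within? H s x) (w x))  ≡⟨ sumℕ-pullback-≡ col (within? H s x) injective (w x) support ⟩
      sumℕ (w x)                                 ≡⟨ Valid.weight-total (valid x) ⟩
      N                                          ∎
      where
      open ≡-Reasoning
      injective = Valid.colour-injective (valid x)
      support : ∀ c → w x c ≢ 0 → ∃ λ z → Within H s x z × col z ≡ c
      support c w≢0 = let z , z∈Bᵣx , e = Valid.weight-support (valid x) c w≢0 in z , Bᵣx⊆Bₛx z∈Bᵣx , e

    sumℕ-∣decoded-decoded∣≤ : ∀ {x y} → adj H x y ≡ true →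
      sumℕ (λ z → ℕ.∣ decoded x z - decoded y z ∣) ≤ weightDist (L x) (L y)
    sumℕ-∣decoded-decoded∣≤ {x} {y} xy = ≤-trans (≤-reflexive (sumℕ-cong pointwise))
      (sumℕ-pullback-≤ col (within? H s x) (Valid.colour-injective (valid x)) (λ c → ℕ.∣ w x c - w y c ∣))
      where
      pointwise : ∀ z → ℕ.∣ decoded x z - decoded y z ∣ ≡
                        pullback col (within? H s x) (λ c → ℕ.∣ w x c - w y c ∣) z
      pointwise z = trans (cong₂ ℕ.∣_-_∣ (decoded≡pullback {x} {x} Bᵣx⊆Bₛx z)
                                          (decoded≡pullback {x} {y} (within-trans H (step xy here)) z))
                          (sym (*-distribˡ-∣-∣ (𝟙 (within? H s x z)) (w x (col z)) (w y (col z))))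

    uniform : Uniform ε′ r H
    uniform = μ , (λ x → normalise-isProb N (decoded x) (sumℕ-decoded x)) , close , support
      where
      μ : Vertex → Vertex → ℚ
      μ x = normalise N (decoded x)

      close : ∀ x y → adj H x y ≡ true → dist₁ (μ x) (μ y) < ε′
      close x y xy = dist₁-normalise< N (decoded x) (decoded y) (sumℕ-∣decoded-decoded∣≤ xy)
                                      (Valid.weight-close (valid x) y xy)

      support : ∀ x z → μ x z ≢ 0ℚ → Within H r x z
      support x z μ≢0 = proj₁ (𝟙*≢0 (within? H r x z) _ (normalise≢0⇒ N (decoded x) z μ≢0))

  module _ .{{_ : ℕ.NonZero N}} {ε} (N-large : fromℕ (4 * ballBound d r) ℚ.≤ fromℕ N ℚ.* (ε′ ℚ.- ε))
           (G : Graph) (maxDeg : MaxDeg≤ d G) (f : Fin (size G) → Fin (size G) → ℚ)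
           (f-prob : ∀ x → IsProb (f x)) (f-close : ∀ x y → adj G x y ≡ true → dist₁ (f x) (f y) ℚ.< ε)
           (f-support : ∀ x y → f x y ≢ 0ℚ → Within G r x y) where
    open import Data.Nat.Base using (_≤_)
    open import Data.Nat.Properties using (≤-trans; ≤-reflexive)
    open import Relation.Nullary.Decidable using (¬?)

    private
      Vertex = Fin (size G)

    rounded : Vertex → Vertex → ℕ
    rounded x = round N (f x) x

    rounded-support : ∀ x z → rounded x z ≢ 0 → Within G r x z
    rounded-support x z rounded≢0 with round≢0⇒ N (f x) x z rounded≢0
    ... | inj₁ refl = here
    ... | inj₂ f≢0  = f-support x z f≢0

    supportSize≤ballBound : ∀ x → supportSize (f x) ≤ ballBound d r
    supportSize≤ballBound x =
      ≤-trans (sumℕ-mono (λ z → 𝟙-mono (¬? (f x z ℚ.≟ 0ℚ)) (within? G r x z) (f-support x z)))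
              (ballSize≤ballBound G maxDeg r x)

    private
      col : Vertex → Fin colours
      col = proj₁ (distanceColouring G maxDeg (s + s))

      col-proper : ∀ {u v} → Within G (s + s) u v → col u ≡ col v → u ≡ v
      col-proper = proj₂ (distanceColouring G maxDeg (s + s))

      aggregated : Vertex → Fin colours → ℕ
      aggregated x = pushforward col (rounded x)

      sumℕ-aggregated : ∀ x → sumℕ (aggregated x) ≡ N
      sumℕ-aggregated x = trans (sumℕ-pushforward col (rounded x)) (sumℕ-round N (f x) x (f-prob x))

      aggregated≤N : ∀ x c → aggregated x c ≤ N
      aggregated≤N x c = subst (aggregated x c ≤_) (sumℕ-aggregated x) (≤-sumℕ (aggregated x) c)

      aggregated′ : Vertex → Fin colours → Fin (suc N)
      aggregated′ x c = Fin.fromℕ< (s≤s (aggregated≤N x c))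

    labelling : Vertex → Fin q
    labelling x = encode (col x , aggregated′ x)

    private
      colour-labelling : ∀ x → colour (labelling x) ≡ col x
      colour-labelling x = colour-encode (col x) (aggregated′ x)

      weight-labelling : ∀ x c → weight (labelling x) c ≡ aggregated x c
      weight-labelling x c =
        trans (weight-encode (col x) (aggregated′ x) c) (Fin.toℕ-fromℕ< (s≤s (aggregated≤N x c)))

    labelling-valid : ∀ x → Valid G labelling x
    labelling-valid x = record
      { colour-injective = λ wʸ wᶻ e → col-proper (within-trans G (within-sym G wʸ) wᶻ)
                                         (trans (sym (colour-labelling _)) (trans e (colour-labelling _)))
      ; weight-total     = trans (sumℕ-cong (weight-labelling x)) (sumℕ-aggregated x)
      ; weight-support   = weight-support
      ; weight-close     = weight-close }
      where
      weight-support : ∀ c → weight (labelling x) c ≢ 0 → ∃ λ z → Within G r x z × colour (labelling z) ≡ c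
      weight-support c w≢0 with pushforward≢0⇒ col (rounded x) c (subst (_≢ 0) (weight-labelling x c) w≢0)
      ... | z , refl , rounded≢0 = z , rounded-support x z rounded≢0 , colour-labelling z

      weightDist≤ : ∀ y → weightDist (labelling x) (labelling y) ≤ sumℕ (λ z → ∣ rounded x z - rounded y z ∣)
      weightDist≤ y =
        ≤-trans (≤-reflexive (sumℕ-cong (λ c → cong₂ ∣_-_∣ (weight-labelling x c) (weight-labelling y c))))
                (pushforward-contracts col (rounded x) (rounded y))

      weight-close : ∀ y → adj G x y ≡ true →
                     fromℕ (weightDist (labelling x) (labelling y)) ℚ.< fromℕ N ℚ.* ε′
      weight-close y xy = ℚ.≤-<-trans (fromℕ-mono-≤ (weightDist≤ y))
        (round-close N (f-prob x) (f-prob y) x y (supportSize≤ballBound x) (supportSize≤ballBound y)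
                     N-large (f-close x y xy))

  completeness : .{{_ : ℕ.NonZero N}} → ∀ {ε} → fromℕ (4 * ballBound d r) ℚ.≤ fromℕ N ℚ.* (ε′ ℚ.- ε) →
                 ∀ G → InA d ε r G → Σ (Fin (size G) → Fin q) λ T → Accepts V s G T
  completeness N-large G (maxDeg , f , f-prob , f-close , f-support) =
    labelling N-large G maxDeg f f-prob f-close f-support ,
    valid⇒accepts maxDeg (labelling-valid N-large G maxDeg f f-prob f-close f-support)

  soundness : .{{_ : ℕ.NonZero N}} → ∀ H → ¬ Uniform ε′ r H → ∀ T → Rejects V s H T
  soundness H ¬uniform T accepts = ¬uniform (uniform H T (accepts⇒valid accepts))

open import Data.Nat.Base using (_<_; _≤_)

proposition5p1 : (d : ℕ) (ε ε′ : ℚ) (r : ℕ) → 1 < d → 0ℚ ℚ.< ε → ε ℚ.< ε′ → ε′ ℚ.< 1ℚ → 1 ≤ r →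
    Σ ℕ λ q → Σ ℕ λ s → Σ (LRGraph q → Set) λ V →
      1 ≤ s ×
      (∀ B → V B → IsBall s d B) ×
      (∀ G → InA d ε r G → Σ (Fin (size G) → Fin q) λ T → Accepts V s G T) ×
      (∀ H → MaxDeg≤ d H → ¬ Uniform ε′ r H → ∀ T → Rejects V s H T)
proposition5p1 d ε ε′ r _ _ ε<ε′ _ _ =
  let N′ , N-large = archimedean-* (4 ℕ.* ballBound d r) (ε′ ℚ.- ε) (p<q⇒0<q-p ε<ε′)
      open Scheme d r (suc N′) ε′
  in q , s , V , s≤s z≤n , (λ _ → proj₁) , completeness N-large , (λ H _ → soundness H)
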